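{- Let $s\ge 0$ be an integer and let $T$ be an $(sP_1+P_3)$-free tree. Then $T$ has at most $4s$ internal vertices.
   Context: All graphs are finite and simple. $P_r$ denotes the path on $r$ vertices. $sP_1+P_3$ is the disjoint union of $s$ isolated vertices and a path on three vertices. A graph is $H$-free if it contains no induced subgraph isomorphic to $H$. The internal vertices of a tree are its vertices of degree at least $2$. -}

module Defs where

open import Data.Nat using (ℕ; zero; suc; _+_; _≤_; _≤ᵇ_)
open import Data.Fin using (Fin; zero; suc; toℕ; inject₁; fromℕ)
open import Data.Bool using (Bool; true; false; if_then_else_)
open import Data.List using (List; length; filterᵇ; map; sum; allFin)
open import Data.Product using (Σ; _×_)
open import Relation.Binary.PropositionalEquality using (_≡_)
open import Relation.Nullary using (¬_)
open import Function.Definitions using (Injective)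

record Graph (n : ℕ) : Set where
  field
    adj   : Fin n → Fin n → Bool
    sym   : ∀ u v → adj u v ≡ adj v u
    irref : ∀ v → adj v v ≡ false
open Graph public

data Walk {n : ℕ} (G : Graph n) : Fin n → Fin n → Set where
  here : ∀ {v} → Walk G v v
  step : ∀ {u w v} → adj G u w ≡ true → Walk G w v → Walk G u v

Connected : ∀ {n} → Graph n → Set
Connected G = ∀ u v → Walk G u v

record Cycle {n : ℕ} (G : Graph n) : Set where
  field
    m     : ℕ
    c     : Fin (3 + m) → Fin n
    inj   : Injective _≡_ _≡_ c
    edges : ∀ (i : Fin (2 + m)) → adj G (c (inject₁ i)) (c (suc i)) ≡ true
    close : adj G (c (fromℕ (2 + m))) (c zero) ≡ true

Acyclic : ∀ {n} → Graph n → Set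
Acyclic G = ¬ Cycle G

IsTree : ∀ {n} → Graph n → Set
IsTree G = Connected G × Acyclic G

record InducedSub {m n : ℕ} (H : Graph m) (G : Graph n) : Set where
  field
    f   : Fin m → Fin n
    inj : Injective _≡_ _≡_ f
    pres : ∀ i j → adj H i j ≡ adj G (f i) (f j)

Free : ∀ {m n} → Graph m → Graph n → Set
Free H G = ¬ InducedSub H G

degree : ∀ {n} → Graph n → Fin n → ℕ
degree G v = length (filterᵇ (adj G v) (allFin _))

internalCount : ∀ {n} → Graph n → ℕ
internalCount {n} G = length (filterᵇ (λ v → 2 ≤ᵇ degree G v) (allFin n))

-- s P1 + P3 on Fin (3 + s): vertices 0 - 1 - 2 form the path,
-- the remaining s vertices are isolated.
p3adj : ℕ → ℕ → Bool
p3adj 0 1 = true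
p3adj 1 0 = true
p3adj 1 2 = true
p3adj 2 1 = true
p3adj _ _ = false

p3sym : ∀ a b → p3adj a b ≡ p3adj b a
p3sym 0 0 = _≡_.refl
p3sym 0 1 = _≡_.refl
p3sym 0 2 = _≡_.refl
p3sym 0 (suc (suc (suc b))) = _≡_.refl
p3sym 1 0 = _≡_.refl
p3sym 1 1 = _≡_.refl
p3sym 1 2 = _≡_.refl
p3sym 1 (suc (suc (suc b))) = _≡_.refl
p3sym 2 0 = _≡_.refl
p3sym 2 1 = _≡_.refl
p3sym 2 2 = _≡_.refl
p3sym 2 (suc (suc (suc b))) = _≡_.refl
p3sym (suc (suc (suc a))) 0 = _≡_.refl
p3sym (suc (suc (suc a))) 1 = _≡_.refl
p3sym (suc (suc (suc a))) 2 = _≡_.refl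
p3sym (suc (suc (suc a))) (suc (suc (suc b))) = _≡_.refl

p3irr : ∀ a → p3adj a a ≡ false
p3irr 0 = _≡_.refl
p3irr 1 = _≡_.refl
p3irr 2 = _≡_.refl
p3irr (suc (suc (suc a))) = _≡_.refl

sP1+P3 : (s : ℕ) → Graph (3 + s)
sP1+P3 s = record
  { adj = λ i j → p3adj (toℕ i) (toℕ j)
  ; sym = λ i j → p3sym (toℕ i) (toℕ j)
  ; irref = λ i → p3irr (toℕ i)
  }

module Submission where

-- A tree is properly 2-coloured by the parity of walks from a root: a
-- monochromatic edge would close a walk of odd length, and every odd closed
-- walk contains a cycle (cut out a repeated vertex; one of the two resulting
-- closed walks is still odd and shorter).  If there were more than 4s internal vertices,
-- one colour class would contain a set S of at least 2s + 1 of them.  Take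
-- v₀ ∈ S with neighbours y ≠ y′ and let N(y) be the neighbours of y in S.
--   * |N(y)| ≥ s + 2: v₁ – y – v₂ with v₁, v₂ ∈ N(y), and one further
--     neighbour gᵢ ≠ y of each of s other members of N(y); as a tree has no
--     4-cycle the gᵢ are distinct and not adjacent to v₁, v₂.
--   * 2 ≤ |N(y)| ≤ s + 1: v₁ – y – v₂ plus s members of S outside N(y).
--   * |N(y)|, |N(y′)| ≤ 1: y – v₀ – y′ plus s members of S adjacent to neither.


open import Defs
open import Data.Nat using (ℕ; zero; suc; _+_; _*_; _≤_; _≤ᵇ_; _≤?_; z≤n; s≤s)
open import Data.Nat.Tactic.RingSolver using (solve-∀)
open import Data.Nat.Properties
  using ( +-suc; +-comm; m≤m+n; m≤n+m; ≤-refl; ≤-trans; ≤-pred; ≰⇒>; ≤ᵇ⇒≤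
        ; +-monoˡ-≤; +-mono-≤; +-cancelˡ-≤; module ≤-Reasoning)
open import Data.Bool using (Bool; true; false; not; _xor_; T; T?)
open import Data.Bool.Properties
  using (not-distribˡ-xor; not-distribʳ-xor; xor-same; ¬-not; not-injective; T-≡; T-not-≡)
open import Data.Fin using (Fin; zero; suc; inject₁; fromℕ; _≟_)
open import Data.Fin.Properties using (suc-injective)
open import Data.List using (List; []; _∷_; length; filterᵇ; allFin)
open import Data.List.Membership.Propositional using (_∈_)
open import Data.List.Membership.Propositional.Properties using (∈-filter⁻)
open import Data.List.Relation.Unary.Any using (here; there)
open import Data.List.Relation.Unary.All as All using ()
open import Data.List.Relation.Unary.AllPairs using (_∷_)
open import Data.List.Relation.Unary.Unique.Propositional using (Unique)
open import Data.List.Relation.Unary.Unique.Propositional.Properties using (allFin⁺; filter⁺)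
open import Data.List.Relation.Binary.Sublist.Propositional.Properties
  using (filter-⊆; length-mono-≤) renaming (filter⁺ to filter-⊆-filter)
open import Data.Product using (Σ; _×_; _,_; proj₁; proj₂)
open import Data.Sum using (_⊎_; inj₁; inj₂)
open import Data.Empty using (⊥)
open import Function using (_∘_; Equivalence)
open import Function.Definitions using (Injective)
open import Relation.Binary.PropositionalEquality
  using (_≡_; _≢_; ≢-sym; refl; cong; trans; subst; module ≡-Reasoning) renaming (sym to ≡-sym)
open import Relation.Nullary using (yes; no; contradiction)

module _ {A : Set} where

  length-filterᵇ-split : ∀ (p : A → Bool) xs →
    length (filterᵇ p xs) + length (filterᵇ (not ∘ p) xs) ≡ length xs
  length-filterᵇ-split p [] = refl
  length-filterᵇ-split p (x ∷ xs) with p x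
  ... | true  = cong suc (length-filterᵇ-split p xs)
  ... | false = trans (+-suc _ _) (cong suc (length-filterᵇ-split p xs))

  length-filterᵇ-filterᵇ : ∀ (p q : A → Bool) xs →
    length (filterᵇ p (filterᵇ q xs)) ≤ length (filterᵇ p xs)
  length-filterᵇ-filterᵇ p q xs =
    length-mono-≤ (filter-⊆-filter (T? ∘ p) (T? ∘ p) (λ { refl t → t }) (filter-⊆ (T? ∘ q) xs))

  choose : ∀ s (xs : List A) → Unique xs → s ≤ length xs →
    Σ (Fin s → A) λ g → Injective _≡_ _≡_ g × (∀ i → g i ∈ xs)
  choose zero xs _ _ = (λ ()) , (λ { {()} }) , λ ()
  choose (suc s) (x ∷ xs) (x∉xs ∷ unique) (s≤s s≤len)
    with choose s xs unique s≤len
  ... | g , g-inj , g∈ = g′ , inj , mem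
    where
      g′ : Fin (suc s) → A
      g′ zero = x
      g′ (suc i) = g i
      inj : Injective _≡_ _≡_ g′
      inj {zero}  {zero}  _ = refl
      inj {zero}  {suc j} e = contradiction e (All.lookup x∉xs (g∈ j))
      inj {suc i} {zero}  e = contradiction (≡-sym e) (All.lookup x∉xs (g∈ i))
      inj {suc i} {suc j} e = cong suc (g-inj e)
      mem : ∀ i → g′ i ∈ x ∷ xs
      mem zero = here refl
      mem (suc i) = there (g∈ i)

four-halves : ∀ s → (s + s) + (s + s) ≡ 4 * s
four-halves = solve-∀

≤-rest-of-split : ∀ s a b → suc (s + s) ≤ a + b → a ≤ suc s → s ≤ b
≤-rest-of-split s a b big a≤ = +-cancelˡ-≤ s s b (≤-pred (≤-trans big (+-monoˡ-≤ b a≤)))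

≤-rest-of-split₃ : ∀ s a b c → suc (s + s) ≤ a + (b + c) → a ≤ 1 → b ≤ 1 → s ≤ c
≤-rest-of-split₃ zero    a b c _   _   _   = z≤n
≤-rest-of-split₃ (suc s) a b c big a≤1 b≤1 =
  ≤-trans (m≤n+m (suc s) s) (≤-pred (≤-pred (≤-trans big (+-mono-≤ a≤1 (+-monoˡ-≤ c b≤1)))))

odd : ℕ → Bool
odd zero = false
odd (suc n) = not (odd n)

odd-+ : ∀ m n → odd (m + n) ≡ odd m xor odd n
odd-+ zero n = refl
odd-+ (suc m) n = trans (cong not (odd-+ m n)) (not-distribˡ-xor (odd m) (odd n))

odd-+⁻ : ∀ m n → odd (m + n) ≡ true → odd m ≡ true ⊎ odd n ≡ true
odd-+⁻ m n odd-sum with odd m | odd-+ m n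
... | true  | _ = inj₁ refl
... | false | eq = inj₂ (trans (≡-sym eq) odd-sum)

module _ {n : ℕ} (G : Graph n) where

  adj-sym : ∀ {u v} → adj G u v ≡ true → adj G v u ≡ true
  adj-sym {u} {v} uv = trans (sym G v u) uv

  non-adj-sym : ∀ {u v} → adj G u v ≡ false → adj G v u ≡ false
  non-adj-sym {u} {v} uv = trans (sym G v u) uv

  separated : ∀ {a b w} → adj G a w ≡ true → adj G b w ≡ false → a ≢ b
  separated aw bw refl with trans (≡-sym aw) bw
  ... | ()

  adjacent⇒distinct : ∀ {u v} → adj G u v ≡ true → u ≢ v
  adjacent⇒distinct {v = v} uv = separated uv (irref G v)

  len : ∀ {u v} → Walk G u v → ℕ
  len here = 0
  len (step _ w) = suc (len w)

  vertex : ∀ {u v} (w : Walk G u v) → Fin (suc (len w)) → Fin n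
  vertex {u} _ zero = u
  vertex (step _ w) (suc i) = vertex w i

  vertex-last : ∀ {u v} (w : Walk G u v) → vertex w (fromℕ (len w)) ≡ v
  vertex-last here = refl
  vertex-last (step _ w) = vertex-last w

  vertex-edge : ∀ {u v} (w : Walk G u v) (i : Fin (len w)) →
    adj G (vertex w (inject₁ i)) (vertex w (suc i)) ≡ true
  vertex-edge (step e w) zero = e
  vertex-edge (step e w) (suc i) = vertex-edge w i

  _++_ : ∀ {u v x} → Walk G u v → Walk G v x → Walk G u x
  here ++ w′ = w′
  step e w ++ w′ = step e (w ++ w′)

  len-++ : ∀ {u v x} (w : Walk G u v) (w′ : Walk G v x) → len (w ++ w′) ≡ len w + len w′
  len-++ here w′ = refl
  len-++ (step e w) w′ = cong suc (len-++ w w′)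

  reverse : ∀ {u v} → Walk G u v → Walk G v u
  reverse here = here
  reverse (step e w) = reverse w ++ step (adj-sym e) here

  len-reverse : ∀ {u v} (w : Walk G u v) → len (reverse w) ≡ len w
  len-reverse here = refl
  len-reverse (step e w) =
    trans (len-++ (reverse w) _) (trans (+-comm _ 1) (cong suc (len-reverse w)))

  IsPath : ∀ {u v} → Walk G u v → Set
  IsPath w = Injective _≡_ _≡_ (vertex w)

  step-path : ∀ {u x v} (e : adj G u x ≡ true) {w : Walk G x v} →
    IsPath w → (∀ i → vertex w i ≢ u) → IsPath (step e w)
  step-path e path u∉w {zero}  {zero}  _  = refl
  step-path e path u∉w {zero}  {suc j} eq = contradiction (≡-sym eq) (u∉w j)
  step-path e path u∉w {suc i} {zero}  eq = contradiction eq (u∉w i)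
  step-path e path u∉w {suc i} {suc j} eq = cong suc (path eq)

  here-path : ∀ {v} → IsPath (here {v = v})
  here-path {_} {zero} {zero} _ = refl

  path⇒cycle : ∀ {u v} (w : Walk G u v) → IsPath w → 2 ≤ len w → adj G v u ≡ true → Cycle G
  path⇒cycle (step _ here) _ (s≤s ()) _
  path⇒cycle {u} w@(step _ (step _ w″)) path _ vu = record
    { m     = len w″
    ; c     = vertex w
    ; inj   = path
    ; edges = vertex-edge w
    ; close = subst (λ y → adj G y u ≡ true) (≡-sym (vertex-last w)) vu
    }

  odd-closed-path⇒cycle : ∀ {v x} (e : adj G v x ≡ true) (w : Walk G x v) →
    IsPath w → odd (len (step e w)) ≡ true → Cycle G
  odd-closed-path⇒cycle e here _ _ = contradiction refl (adjacent⇒distinct e)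
  odd-closed-path⇒cycle e (step _ here) _ ()
  odd-closed-path⇒cycle e w@(step _ (step _ _)) path _ = path⇒cycle w path (s≤s (s≤s z≤n)) e

  split-at : ∀ {u v} (x : Fin n) (w : Walk G u v) →
    (Σ (Walk G u x) λ p → Σ (Walk G x v) λ q → len p + len q ≡ len w)
    ⊎ (∀ i → vertex w i ≢ x)
  split-at {u} x w with u ≟ x
  split-at x w | yes refl = inj₁ (here , w , refl)
  split-at x here | no u≢x = inj₂ λ { zero → u≢x }
  split-at x (step e w) | no u≢x with split-at x w
  ... | inj₁ (p , q , eq) = inj₁ (step e p , q , cong suc eq)
  ... | inj₂ x∉w = inj₂ λ { zero → u≢x ; (suc i) → x∉w i }

  record Detour {u v} (w : Walk G u v) : Set where
    field
      {centre}      : Fin n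
      loop          : Walk G centre centre
      rest          : Walk G u v
      loop-nonempty : 1 ≤ len loop
      len-split     : len loop + len rest ≡ len w

  -- Every walk is a path or has a detour: walk along w until its first
  -- vertex reappears further on.
  path-or-detour : ∀ {u v} (w : Walk G u v) → IsPath w ⊎ Detour w
  path-or-detour here = inj₁ here-path
  path-or-detour (step e w) with path-or-detour w
  ... | inj₂ d = inj₂ record
    { loop = loop ; rest = step e rest ; loop-nonempty = loop-nonempty
    ; len-split = trans (+-suc (len loop) (len rest)) (cong suc len-split) }
    where open Detour d
  ... | inj₁ path with split-at _ w
  ...   | inj₁ (p , q , eq) = inj₂ record
    { loop = step e p ; rest = q ; loop-nonempty = s≤s z≤n ; len-split = cong suc eq }
  ...   | inj₂ u∉w = inj₁ (step-path e path u∉w)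

  -- Every closed walk of odd length yields a cycle; by induction on a bound k
  -- for its length, cutting out detours until a closed path remains.
  odd-closed-walk⇒cycle : ∀ k {v} (w : Walk G v v) → len w ≤ k → odd (len w) ≡ true → Cycle G
  odd-closed-walk⇒cycle (suc k) (step e w) (s≤s len≤k) odd-w with path-or-detour w
  ... | inj₁ path = odd-closed-path⇒cycle e w path odd-w
  ... | inj₂ d = shorten (odd-+⁻ (len loop) (len (step e rest)) odd-parts)
    where
      open Detour d
      bound : len loop + len rest ≤ k
      bound = subst (_≤ k) (≡-sym len-split) len≤k
      -- the closed walk step e w splits into loop and step e rest
      odd-parts : odd (len loop + suc (len rest)) ≡ true
      odd-parts = subst (λ m → odd m ≡ true)
        (trans (cong suc (≡-sym len-split)) (≡-sym (+-suc (len loop) (len rest)))) odd-w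
      shorten : odd (len loop) ≡ true ⊎ odd (len (step e rest)) ≡ true → Cycle G
      shorten (inj₁ odd-loop) =
        odd-closed-walk⇒cycle k loop (≤-trans (m≤m+n (len loop) (len rest)) bound) odd-loop
      shorten (inj₂ odd-rest) =
        odd-closed-walk⇒cycle k (step e rest) (≤-trans (+-monoˡ-≤ (len rest) loop-nonempty) bound) odd-rest

  no-four-cycle : Acyclic G → ∀ {a b c d} → adj G a b ≡ true → adj G b c ≡ true →
    adj G c d ≡ true → adj G d a ≡ true → a ≢ c → b ≢ d → ⊥
  no-four-cycle acyclic ab bc cd da a≢c b≢d = acyclic (path⇒cycle abcd path (s≤s (s≤s z≤n)) da)
    where
      abcd = step ab (step bc (step cd here))
      path : IsPath abcd
      path = step-path ab
        (step-path bc
          (step-path cd here-path λ { zero → ≢-sym (adjacent⇒distinct cd) })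
          λ { zero → ≢-sym (adjacent⇒distinct bc) ; (suc zero) → ≢-sym b≢d })
        λ { zero → ≢-sym (adjacent⇒distinct ab) ; (suc zero) → ≢-sym a≢c
          ; (suc (suc zero)) → adjacent⇒distinct da }

  ProperColouring : (Fin n → Bool) → Set
  ProperColouring col = ∀ {u v} → adj G u v ≡ true → col u ≢ col v

  -- An acyclic graph all of whose vertices are reachable from r is properly
  -- 2-coloured by the parity of given walks from r: a monochromatic edge would
  -- close an odd closed walk, hence a cycle.
  acyclic⇒colouring : Acyclic G → (r : Fin n) → (∀ v → Walk G r v) →
    Σ (Fin n → Bool) ProperColouring
  acyclic⇒colouring acyclic r walk = col , proper
    where
      col : Fin n → Bool
      col v = odd (len (walk v))
      proper : ProperColouring col
      proper {u} {v} uv same = acyclic (odd-closed-walk⇒cycle _ circuit ≤-refl odd-circuit)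
        where
          circuit = walk u ++ step uv (reverse (walk v))
          odd-circuit : odd (len circuit) ≡ true
          odd-circuit = begin
            odd (len circuit)
              ≡⟨ cong odd (len-++ (walk u) _) ⟩
            odd (len (walk u) + suc (len (reverse (walk v))))
              ≡⟨ cong (λ m → odd (len (walk u) + suc m)) (len-reverse (walk v)) ⟩
            odd (len (walk u) + suc (len (walk v)))
              ≡⟨ odd-+ (len (walk u)) _ ⟩
            col u xor not (col v)
              ≡⟨ cong (λ b → b xor not (col v)) same ⟩
            col v xor not (col v)
              ≡⟨ ≡-sym (not-distribʳ-xor (col v) (col v)) ⟩
            not (col v xor col v)
              ≡⟨ cong not (xor-same (col v)) ⟩
            true ∎
            where open ≡-Reasoning

  module _ {col : Fin n → Bool} (proper : ProperColouring col) where

    same-colour⇒non-adjacent : ∀ {u v} → col u ≡ col v → adj G u v ≡ false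
    same-colour⇒non-adjacent same = ¬-not λ uv → proper uv same

    two-steps⇒same-colour : ∀ {u v w} → adj G u v ≡ true → adj G v w ≡ true → col u ≡ col w
    two-steps⇒same-colour uv vw = trans (¬-not (proper uv)) (≡-sym (¬-not (proper (adj-sym vw))))

    swap-colours : ProperColouring (not ∘ col)
    swap-colours uv same = proper uv (not-injective same)

  induced-sP1+P3 : ∀ {s} {x c z : Fin n} (g : Fin s → Fin n) →
    adj G x c ≡ true → adj G c z ≡ true → adj G x z ≡ false → x ≢ z →
    Injective _≡_ _≡_ g → (∀ i j → adj G (g i) (g j) ≡ false) →
    (∀ i → adj G x (g i) ≡ false) → (∀ i → adj G c (g i) ≡ false) →
    (∀ i → adj G z (g i) ≡ false) → InducedSub (sP1+P3 s) G
  induced-sP1+P3 {s} {x} {c} {z} g xc cz xz x≢z g-inj gg xg cg zg =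
    record { f = f ; inj = inj ; pres = pres }
    where
      f : Fin (3 + s) → Fin n
      f zero                = x
      f (suc zero)          = c
      f (suc (suc zero))    = z
      f (suc (suc (suc k))) = g k
      x≢c : x ≢ c
      x≢c = adjacent⇒distinct xc
      c≢z : c ≢ z
      c≢z = adjacent⇒distinct cz
      x≢g : ∀ k → x ≢ g k
      x≢g k = separated xc (non-adj-sym (cg k))
      c≢g : ∀ k → c ≢ g k
      c≢g k = separated (adj-sym xc) (non-adj-sym (xg k))
      z≢g : ∀ k → z ≢ g k
      z≢g k = separated (adj-sym cz) (non-adj-sym (cg k))
      inj : Injective _≡_ _≡_ f
      inj {zero}                {zero}                _ = refl
      inj {zero}                {suc zero}            e = contradiction e x≢c
      inj {zero}                {suc (suc zero)}      e = contradiction e x≢z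
      inj {zero}                {suc (suc (suc l))}   e = contradiction e (x≢g l)
      inj {suc zero}            {zero}                e = contradiction (≡-sym e) x≢c
      inj {suc zero}            {suc zero}            _ = refl
      inj {suc zero}            {suc (suc zero)}      e = contradiction e c≢z
      inj {suc zero}            {suc (suc (suc l))}   e = contradiction e (c≢g l)
      inj {suc (suc zero)}      {zero}                e = contradiction (≡-sym e) x≢z
      inj {suc (suc zero)}      {suc zero}            e = contradiction (≡-sym e) c≢z
      inj {suc (suc zero)}      {suc (suc zero)}      _ = refl
      inj {suc (suc zero)}      {suc (suc (suc l))}   e = contradiction e (z≢g l)
      inj {suc (suc (suc k))}   {zero}                e = contradiction (≡-sym e) (x≢g k)
      inj {suc (suc (suc k))}   {suc zero}            e = contradiction (≡-sym e) (c≢g k)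
      inj {suc (suc (suc k))}   {suc (suc zero)}      e = contradiction (≡-sym e) (z≢g k)
      inj {suc (suc (suc k))}   {suc (suc (suc l))}   e = cong (λ k → suc (suc (suc k))) (g-inj e)
      pres : ∀ i j → adj (sP1+P3 s) i j ≡ adj G (f i) (f j)
      pres zero                zero                = ≡-sym (irref G x)
      pres zero                (suc zero)          = ≡-sym xc
      pres zero                (suc (suc zero))    = ≡-sym xz
      pres zero                (suc (suc (suc l))) = ≡-sym (xg l)
      pres (suc zero)          zero                = ≡-sym (adj-sym xc)
      pres (suc zero)          (suc zero)          = ≡-sym (irref G c)
      pres (suc zero)          (suc (suc zero))    = ≡-sym cz
      pres (suc zero)          (suc (suc (suc l))) = ≡-sym (cg l)
      pres (suc (suc zero))    zero                = ≡-sym (non-adj-sym xz)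
      pres (suc (suc zero))    (suc zero)          = ≡-sym (adj-sym cz)
      pres (suc (suc zero))    (suc (suc zero))    = ≡-sym (irref G z)
      pres (suc (suc zero))    (suc (suc (suc l))) = ≡-sym (zg l)
      pres (suc (suc (suc k))) zero                = ≡-sym (non-adj-sym (xg k))
      pres (suc (suc (suc k))) (suc zero)          = ≡-sym (non-adj-sym (cg k))
      pres (suc (suc (suc k))) (suc (suc zero))    = ≡-sym (non-adj-sym (zg k))
      pres (suc (suc (suc k))) (suc (suc (suc l))) = ≡-sym (gg k l)

  ∈-adjacent : ∀ {y v} xs → v ∈ filterᵇ (adj G y) xs → adj G y v ≡ true × v ∈ xs
  ∈-adjacent {y} xs v∈ with ∈-filter⁻ (T? ∘ adj G y) {xs = xs} v∈
  ... | v∈xs , yv = Equivalence.to T-≡ yv , v∈xs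

  ∈-non-adjacent : ∀ {y v} xs → v ∈ filterᵇ (not ∘ adj G y) xs → adj G y v ≡ false × v ∈ xs
  ∈-non-adjacent {y} xs v∈ with ∈-filter⁻ (T? ∘ not ∘ adj G y) {xs = xs} v∈
  ... | v∈xs , y≁v = Equivalence.to T-not-≡ y≁v , v∈xs

  neighbours : Fin n → List (Fin n)
  neighbours v = filterᵇ (adj G v) (allFin n)

  internal : Fin n → Bool
  internal v = 2 ≤ᵇ degree G v

  two-neighbours : ∀ {v} → T (internal v) →
    Σ (Fin n) λ a → Σ (Fin n) λ b → adj G v a ≡ true × adj G v b ≡ true × a ≢ b
  two-neighbours {v} int with choose 2 (neighbours v) (filter⁺ _ (allFin⁺ n)) (≤ᵇ⇒≤ 2 _ int)
  ... | g , g-inj , g∈ =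
    g zero , g (suc zero) , proj₁ (∈-adjacent (allFin n) (g∈ zero)) ,
    proj₁ (∈-adjacent (allFin n) (g∈ (suc zero))) ,
    λ e → contradiction (g-inj e) λ ()

  another-neighbour : ∀ {v} → T (internal v) → (y : Fin n) → Σ (Fin n) λ w → adj G v w ≡ true × w ≢ y
  another-neighbour int y with two-neighbours int
  ... | a , b , va , vb , a≢b with a ≟ y
  ...   | yes refl = b , vb , ≢-sym a≢b
  ...   | no a≢y   = a , va , a≢y

  module ColourClass (acyclic : Acyclic G) {col : Fin n → Bool} (proper : ProperColouring col) where

    class : List (Fin n)
    class = filterᵇ col (filterᵇ internal (allFin n))

    class-unique : Unique class
    class-unique = filter⁺ (T? ∘ col) (filter⁺ (T? ∘ internal) (allFin⁺ n))

    ∈-class : ∀ {v} → v ∈ class → col v ≡ true × T (internal v)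
    ∈-class {v} v∈ with ∈-filter⁻ (T? ∘ col) {xs = filterᵇ internal (allFin n)} v∈
    ... | v∈int , cv = Equivalence.to T-≡ cv , proj₂ (∈-filter⁻ (T? ∘ internal) {xs = allFin n} v∈int)

    class-non-adjacent : ∀ {u v} → u ∈ class → v ∈ class → adj G u v ≡ false
    class-non-adjacent u∈ v∈ =
      same-colour⇒non-adjacent proper (trans (proj₁ (∈-class u∈)) (≡-sym (proj₁ (∈-class v∈))))

    class-neighbours class-non-neighbours : Fin n → List (Fin n)
    class-neighbours y = filterᵇ (adj G y) class
    class-non-neighbours y = filterᵇ (not ∘ adj G y) class

    -- A path x – c – z plus s distinct class members avoiding x, c and z
    -- (the latter are pairwise non-adjacent, having the same colour).
    induced-with-class-members : ∀ s {x c z} (R : List (Fin n)) → Unique R → s ≤ length R →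
      (∀ {r} → r ∈ R → r ∈ class × adj G x r ≡ false × adj G c r ≡ false × adj G z r ≡ false) →
      adj G x c ≡ true → adj G c z ≡ true → adj G x z ≡ false → x ≢ z → InducedSub (sP1+P3 s) G
    induced-with-class-members s R R-unique s≤ avoid xc cz xz x≢z with choose s R R-unique s≤
    ... | g , g-inj , g∈ = induced-sP1+P3 g xc cz xz x≢z g-inj
      (λ i j → class-non-adjacent (proj₁ (avoid (g∈ i))) (proj₁ (avoid (g∈ j))))
      (λ i → proj₁ (proj₂ (avoid (g∈ i))))
      (λ i → proj₁ (proj₂ (proj₂ (avoid (g∈ i)))))
      (λ i → proj₂ (proj₂ (proj₂ (avoid (g∈ i)))))

    -- A vertex y with at least s + 2 class neighbours: two of them, v₁ and v₂,
    -- form the path v₁ – y – v₂, and each further class neighbour hᵢ (being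
    -- internal) has a neighbour gᵢ ≠ y; the gᵢ are the isolated vertices.
    -- No 4-cycle means distinct hᵢ have distinct gᵢ, and no gᵢ is adjacent to
    -- v₁ or v₂; the gᵢ share the colour of y, so they are mutually
    -- non-adjacent and non-adjacent to y.
    many-neighbours⇒induced : ∀ s y → 2 + s ≤ length (class-neighbours y) → InducedSub (sP1+P3 s) G
    many-neighbours⇒induced s y many
      with choose (2 + s) (class-neighbours y) (filter⁺ (T? ∘ adj G y) class-unique) many
    ... | h , h-inj , h∈ = induced-sP1+P3 g
      (adj-sym (y~h zero)) (y~h (suc zero)) (class-non-adjacent (h-class zero) (h-class (suc zero)))
      (λ e → contradiction (h-inj e) λ ())
      g-inj
      (λ i j → same-colour⇒non-adjacent proper (trans (≡-sym (y-g-colour i)) (y-g-colour j)))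
      (λ i → hub≁g zero i λ e → contradiction (h-inj e) λ ())
      (λ i → same-colour⇒non-adjacent proper (y-g-colour i))
      (λ i → hub≁g (suc zero) i λ e → contradiction (h-inj e) λ ())
      where
        y~h : ∀ k → adj G y (h k) ≡ true
        y~h k = proj₁ (∈-adjacent class (h∈ k))
        h-class : ∀ k → h k ∈ class
        h-class k = proj₂ (∈-adjacent class (h∈ k))
        leaf : Fin s → Fin n
        leaf i = h (suc (suc i))
        pendant : ∀ i → Σ (Fin n) λ w → adj G (leaf i) w ≡ true × w ≢ y
        pendant i = another-neighbour (proj₂ (∈-class (h-class (suc (suc i))))) y
        g : Fin s → Fin n
        g i = proj₁ (pendant i)
        leaf~g : ∀ i → adj G (leaf i) (g i) ≡ true
        leaf~g i = proj₁ (proj₂ (pendant i))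
        g≢y : ∀ i → g i ≢ y
        g≢y i = proj₂ (proj₂ (pendant i))
        y-g-colour : ∀ i → col y ≡ col (g i)
        y-g-colour i = two-steps⇒same-colour proper (y~h (suc (suc i))) (leaf~g i)
        -- y – h k – g i – leaf i – y would be a 4-cycle
        hub≁g : ∀ k i → h k ≢ leaf i → adj G (h k) (g i) ≡ false
        hub≁g k i hk≢leaf = ¬-not λ hk~g → no-four-cycle acyclic (y~h k) hk~g
          (adj-sym (leaf~g i)) (adj-sym (y~h (suc (suc i)))) (≢-sym (g≢y i)) hk≢leaf
        g-inj : Injective _≡_ _≡_ g
        g-inj {i} {j} gi≡gj with i ≟ j
        ... | yes i≡j = i≡j
        ... | no i≢j = contradiction gi≡gj
          (separated (adj-sym (leaf~g i)) (non-adj-sym (hub≁g (suc (suc i)) j leaf-i≢leaf-j)))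
          where
            leaf-i≢leaf-j : leaf i ≢ leaf j
            leaf-i≢leaf-j e = i≢j (suc-injective (suc-injective (h-inj e)))

    -- A vertex y with at least two class neighbours: if it has s + 2 of them,
    -- use the previous lemma; otherwise two of them, v₁ – y – v₂, together with
    -- the (at least s) class members not adjacent to y.
    hub⇒induced : ∀ s y → 2 ≤ length (class-neighbours y) → suc (s + s) ≤ length class →
      InducedSub (sP1+P3 s) G
    hub⇒induced s y two big with 2 + s ≤? length (class-neighbours y)
    ... | yes many = many-neighbours⇒induced s y many
    ... | no not-many with choose 2 (class-neighbours y) (filter⁺ (T? ∘ adj G y) class-unique) two
    ...   | v , v-inj , v∈ = induced-with-class-members s (class-non-neighbours y)
            (filter⁺ (T? ∘ not ∘ adj G y) class-unique) enough avoid
            (adj-sym (y~v zero)) (y~v (suc zero)) (class-non-adjacent (v-class zero) (v-class (suc zero)))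
            (λ e → contradiction (v-inj e) λ ())
      where
        y~v : ∀ k → adj G y (v k) ≡ true
        y~v k = proj₁ (∈-adjacent class (v∈ k))
        v-class : ∀ k → v k ∈ class
        v-class k = proj₂ (∈-adjacent class (v∈ k))
        enough : s ≤ length (class-non-neighbours y)
        enough = ≤-rest-of-split s _ _
          (subst (suc (s + s) ≤_) (≡-sym (length-filterᵇ-split (adj G y) class)) big)
          (≤-pred (≰⇒> not-many))
        avoid : ∀ {r} → r ∈ class-non-neighbours y →
          r ∈ class × adj G (v zero) r ≡ false × adj G y r ≡ false × adj G (v (suc zero)) r ≡ false
        avoid r∈ with ∈-non-adjacent class r∈
        ... | y≁r , r∈class =
          r∈class , class-non-adjacent (v-class zero) r∈class , y≁r ,
          class-non-adjacent (v-class (suc zero)) r∈class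

    lonely-neighbours⇒induced : ∀ s {v₀ y y′} → v₀ ∈ class →
      adj G v₀ y ≡ true → adj G v₀ y′ ≡ true → y ≢ y′ →
      length (class-neighbours y) ≤ 1 → length (class-neighbours y′) ≤ 1 →
      suc (s + s) ≤ length class → InducedSub (sP1+P3 s) G
    lonely-neighbours⇒induced s {v₀} {y} {y′} v₀∈ v₀y v₀y′ y≢y′ few few′ big =
      induced-with-class-members s R
        (filter⁺ (T? ∘ not ∘ adj G y′) (filter⁺ (T? ∘ not ∘ adj G y) class-unique)) enough avoid
        (adj-sym v₀y) v₀y′
        (same-colour⇒non-adjacent proper (two-steps⇒same-colour proper (adj-sym v₀y) v₀y′)) y≢y′
      where
        R : List (Fin n)
        R = filterᵇ (not ∘ adj G y′) (class-non-neighbours y)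
        -- the class splits into neighbours of y, then neighbours of y′, then R
        counted : length class ≡
          length (class-neighbours y) + (length (filterᵇ (adj G y′) (class-non-neighbours y)) + length R)
        counted = trans (≡-sym (length-filterᵇ-split (adj G y) class))
          (cong (length (class-neighbours y) +_)
                (≡-sym (length-filterᵇ-split (adj G y′) (class-non-neighbours y))))
        enough : s ≤ length R
        enough = ≤-rest-of-split₃ s _ _ _ (subst (suc (s + s) ≤_) counted big) few
          (≤-trans (length-filterᵇ-filterᵇ (adj G y′) (not ∘ adj G y) class) few′)
        avoid : ∀ {r} → r ∈ R →
          r ∈ class × adj G y r ≡ false × adj G v₀ r ≡ false × adj G y′ r ≡ false
        avoid r∈ with ∈-non-adjacent (class-non-neighbours y) r∈
        ... | y′≁r , r∈′ with ∈-non-adjacent class r∈′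
        ...   | y≁r , r∈class = r∈class , y≁r , class-non-adjacent v₀∈ r∈class , y′≁r

    big-class⇒induced : ∀ s → suc (s + s) ≤ length class → InducedSub (sP1+P3 s) G
    big-class⇒induced s big with choose 1 class class-unique (≤-trans (s≤s z≤n) big)
    ... | v , _ , v∈ with two-neighbours (proj₂ (∈-class (v∈ zero)))
    ... | y , y′ , v₀y , v₀y′ , y≢y′
      with 2 ≤? length (class-neighbours y) | 2 ≤? length (class-neighbours y′)
    ... | yes hub | _        = hub⇒induced s y hub big
    ... | no _    | yes hub′ = hub⇒induced s y′ hub′ big
    ... | no few  | no few′  = lonely-neighbours⇒induced s (v∈ zero) v₀y v₀y′ y≢y′
                                 (≤-pred (≰⇒> few)) (≤-pred (≰⇒> few′)) big

  -- A properly 2-coloured (sP1+P3)-free forest has at most 4s internal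
  -- vertices: each colour class contains at most 2s of them.
  internal-bound : Acyclic G → ∀ {col} → ProperColouring col → ∀ s → Free (sP1+P3 s) G →
    length (filterᵇ internal (allFin n)) ≤ 4 * s
  internal-bound acyclic {col} proper s free = begin
    length (filterᵇ internal (allFin n))
      ≡⟨ ≡-sym (length-filterᵇ-split col (filterᵇ internal (allFin n))) ⟩
    length (ColourClass.class acyclic proper) + length (ColourClass.class acyclic (swap-colours proper))
      ≤⟨ +-mono-≤ (class-bound proper) (class-bound (swap-colours proper)) ⟩
    (s + s) + (s + s)
      ≡⟨ four-halves s ⟩
    4 * s ∎
    where
      open ≤-Reasoning
      class-bound : ∀ {c} (proper-c : ProperColouring c) →
        length (ColourClass.class acyclic proper-c) ≤ s + s
      class-bound proper-c with length (ColourClass.class acyclic proper-c) ≤? s + s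
      ... | yes small = small
      ... | no big = contradiction (ColourClass.big-class⇒induced acyclic proper-c s (≰⇒> big)) free

lemma3 : (s n : ℕ) (T : Graph n) → IsTree T → Free (sP1+P3 s) T →
    internalCount T ≤ 4 * s
lemma3 s zero T _ _ = z≤n
lemma3 s (suc n) T (connected , acyclic) free =
  internal-bound T acyclic (proj₂ (acyclic⇒colouring T acyclic zero (connected zero))) s free
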